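{- For all integers $n>0$, $A$, $B$, $$f(n;A,B)=f(n-1;A-1,B-A+1)+f(n-1;A,B-A)+A\,f(n-1;A,B-A+1)+(A+1)\,f(n-1;A+1,B-A),$$ with initial conditions $f(0;0,0)=1$ and $f(0;A,B)=0$ for $(A,B)\ne(0,0)$.
   Context: A marked set partition of $[n]=\{1,\dots,n\}$ is a set partition of $[n]$ in which each block is marked either open or closed. For a marked set partition $\lambda$ with blocks $\mathbf{B}_1,\mathbf{B}_2,\dots$, let $o(\lambda)$ be the number of open blocks and $\ell(\lambda)$ the total number of blocks, and define $$\tilde d(\lambda)=\sum_{\mathbf{B}_j\text{ closed}}\max(\mathbf{B}_j)-\sum_{\mathbf{B}_j}\min(\mathbf{B}_j)+\ell(\lambda)+n\,(o(\lambda)-1).$$ For integers $n\ge 0$, $A$, $B$, let $f(n;A,B)$ be the number of marked set partitions $\lambda$ of $[n]$ with $o(\lambda)=A$ and $\tilde d(\lambda)=B$ (so $f(n;A,B)=0$ for $A<0$). When $o(\lambda)=0$, $\tilde d(\lambda)$ equals the dimension exponent $\sum_j(\max\mathbf{B}_j-\min\mathbf{B}_j+1)-n$ of the underlying set partition. -}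

module Defs where

open import Data.Nat as ℕ using (ℕ; zero; suc; _≤ᵇ_; _≡ᵇ_)
open import Data.Integer as Int using (ℤ; +_; _-_)
open import Data.Bool using (Bool; true; false; if_then_else_; _∧_)
open import Data.List using (List; []; _∷_; map; concatMap; filter; length; upTo; zip; foldr)
open import Data.Product using (_×_; _,_; proj₁; proj₂)
open import Relation.Binary.PropositionalEquality using (_≡_)
open import Relation.Nullary.Decidable using (_×-dec_)

-- A set partition is encoded by its block word w = w₁ … wₙ, where wᵢ is
-- the index (0-based) of the block containing i, blocks being numbered in
-- increasing order of their minima (restricted growth string).

words : ℕ → ℕ → List (List ℕ)
words k zero    = [] ∷ []
words k (suc n) = concatMap (λ x → map (x ∷_) (words k n)) (upTo k)

-- validity (restricted growth) with current number of blocks k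
rgsOK : ℕ → List ℕ → Bool
rgsOK k []       = true
rgsOK k (x ∷ xs) = (x ≤ᵇ k) ∧ rgsOK (if x ≡ᵇ k then suc k else k) xs

nBlocksFrom : ℕ → List ℕ → ℕ
nBlocksFrom k []       = k
nBlocksFrom k (x ∷ xs) = nBlocksFrom (if x ≡ᵇ k then suc k else k) xs

nBlocks : List ℕ → ℕ
nBlocks = nBlocksFrom 0

setPartitions : ℕ → List (List ℕ)
setPartitions n = filter (λ w → Data.Bool._≟_ (rgsOK 0 w) true) (words n n)
  where import Data.Bool

-- all markings of ℓ blocks (true = open, false = closed); the j-th entry
-- is the mark of block j
markings : ℕ → List (List Bool)
markings zero    = [] ∷ []
markings (suc l) = concatMap (λ b → map (b ∷_) (markings l)) (true ∷ false ∷ [])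

MarkedSP : Set
MarkedSP = List ℕ × List Bool

markedSetPartitions : ℕ → List MarkedSP
markedSetPartitions n =
  concatMap (λ w → map (w ,_) (markings (nBlocks w))) (setPartitions n)

-- min / max of block j (1-based positions); pos is position of head
minFrom : ℕ → ℕ → List ℕ → ℕ
minFrom j pos []       = 0
minFrom j pos (x ∷ xs) = if x ≡ᵇ j then pos else minFrom j (suc pos) xs

maxFrom : ℕ → ℕ → List ℕ → ℕ
maxFrom j pos []       = 0
maxFrom j pos (x ∷ xs) = if x ≡ᵇ j then ℕ._⊔_ pos (maxFrom j (suc pos) xs)
                                   else maxFrom j (suc pos) xs

minBlock maxBlock : List ℕ → ℕ → ℕ
minBlock w j = minFrom j 1 w
maxBlock w j = maxFrom j 1 w

openCount : MarkedSP → ℕ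
openCount (w , ms) = length (filter (λ b → Data.Bool._≟_ b true) ms)
  where import Data.Bool

ell : MarkedSP → ℕ
ell (w , ms) = nBlocks w

sumℤ : List ℤ → ℤ
sumℤ = foldr Int._+_ (+ 0)

dtilde : ℕ → MarkedSP → ℤ
dtilde n lam@(w , ms) = closedMax - allMin + ell' + nTerm
  where
  open Int using (_+_; _*_)
  closedMax = sumℤ (map (λ jm → if proj₂ jm then + 0 else + maxBlock w (proj₁ jm))
                        (zip (upTo (nBlocks w)) ms))
  allMin    = sumℤ (map (λ j → + minBlock w j) (upTo (nBlocks w)))
  ell'      = + ell lam
  nTerm     = + n * (+ openCount lam - + 1)

f : ℕ → ℤ → ℤ → ℕ
f n A B = length (filter (λ λ' → (+ openCount λ' Int.≟ A) ×-dec (dtilde n λ' Int.≟ B))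
                         (markedSetPartitions n))

module Submission where

-- A marked set partition of [n+1] is obtained in exactly one way
-- from a marked set partition of [n] by inserting n+1
--   (a) as a new singleton block marked open  : o ↦ o+1, d̃ ↦ d̃ + o,
--   (b) as a new singleton block marked closed: o fixed, d̃ ↦ d̃ + o,
--   (c) into an existing open block           : o fixed, d̃ ↦ d̃ + o - 1,
--   (d) into an existing closed block; reading the old block as open this
--       is o+1 ↦ o, d̃ ↦ d̃ + o.
-- Summing indicators, (a),(b) give the first two terms, while (c),(d) give
-- the factors A and A+1 because each open block can receive n+1.
-- The file develops, in order: integer sums over lists; sums over all
-- markings of a fixed number of blocks; the enumeration of set partitions
-- by restricted growth words and its one-letter extension; how block minima,
-- maxima and d̃ change when a letter is appended; how the indicator
-- [o = A, d̃ = B] transforms under these shifts; and finally the recurrence,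
-- obtained per block word and summed over all block words.

open import Defs
open import Data.Nat as ℕ using (ℕ; zero; suc; _≤ᵇ_; _≡ᵇ_; _<_; _≤_; z≤n; s≤s; _⊔_)
import Data.Nat.Properties as ℕP
open import Data.Integer as Int using (ℤ; +_; _+_; _-_; _*_)
import Data.Integer.Properties as IntP
open import Data.Integer.Tactic.RingSolver using (solve-∀)
open import Data.Bool using (Bool; true; false; if_then_else_; _∧_; _∨_)
import Data.Bool.Properties as BoolP
import Data.Bool as Bool
open import Data.List using (List; []; _∷_; map; concatMap; filter; length; upTo; applyUpTo; zip; _++_; _∷ʳ_)
import Data.List.Properties as ListP
open import Data.Product using (_×_; _,_; proj₁; proj₂)
open import Data.Empty using (⊥-elim)
open import Function using (_∘_; id; mk⇔; Equivalence)
open import Relation.Binary.PropositionalEquality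
open import Relation.Nullary using (does; Dec; yes; no; _×-dec_)
open import Relation.Nullary.Decidable using (does-⇔)
open import Relation.Unary using (Pred; Decidable)

∑ : ∀ {a} {A : Set a} → (A → ℤ) → List A → ℤ
∑ F xs = sumℤ (map F xs)

∑-cong : ∀ {a} {A : Set a} {F G : A → ℤ} (xs : List A) → (∀ x → F x ≡ G x) → ∑ F xs ≡ ∑ G xs
∑-cong []       e = refl
∑-cong (x ∷ xs) e = cong₂ _+_ (e x) (∑-cong xs e)

∑-++ : ∀ {a} {A : Set a} (F : A → ℤ) (xs ys : List A) → ∑ F (xs ++ ys) ≡ ∑ F xs + ∑ F ys
∑-++ F []       ys = sym (IntP.+-identityˡ _)
∑-++ F (x ∷ xs) ys = trans (cong (_+_ (F x)) (∑-++ F xs ys)) (sym (IntP.+-assoc (F x) _ _))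

∑-map : ∀ {a b} {A : Set a} {B : Set b} (F : B → ℤ) (g : A → B) (xs : List A) →
        ∑ F (map g xs) ≡ ∑ (F ∘ g) xs
∑-map F g []       = refl
∑-map F g (x ∷ xs) = cong (_+_ (F (g x))) (∑-map F g xs)

∑-concatMap : ∀ {a b} {A : Set a} {B : Set b} (F : B → ℤ) (g : A → List B) (xs : List A) →
              ∑ F (concatMap g xs) ≡ ∑ (λ x → ∑ F (g x)) xs
∑-concatMap F g []       = refl
∑-concatMap F g (x ∷ xs) =
  trans (∑-++ F (g x) (concatMap g xs)) (cong (_+_ (∑ F (g x))) (∑-concatMap F g xs))

∑-+ : ∀ {a} {A : Set a} (F G : A → ℤ) (xs : List A) → ∑ (λ x → F x + G x) xs ≡ ∑ F xs + ∑ G xs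
∑-+ F G []       = refl
∑-+ F G (x ∷ xs) = trans (cong (_+_ (F x + G x)) (∑-+ F G xs)) (interchange (F x) (G x) _ _)
  where
  interchange : ∀ a b c d → a + b + (c + d) ≡ a + c + (b + d)
  interchange = solve-∀

∑-* : ∀ {a} {A : Set a} (c : ℤ) (F : A → ℤ) (xs : List A) → ∑ (λ x → c * F x) xs ≡ c * ∑ F xs
∑-* c F []       = sym (IntP.*-zeroʳ c)
∑-* c F (x ∷ xs) = trans (cong (_+_ (c * F x)) (∑-* c F xs)) (sym (IntP.*-distribˡ-+ c (F x) _))

∑-zero : ∀ {a} {A : Set a} (xs : List A) → ∑ (λ _ → + 0) xs ≡ + 0
∑-zero []       = refl
∑-zero (x ∷ xs) = trans (IntP.+-identityˡ _) (∑-zero xs)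

∑-swap : ∀ {a b} {A : Set a} {B : Set b} (F : A → B → ℤ) (xs : List A) (ys : List B) →
         ∑ (λ x → ∑ (F x) ys) xs ≡ ∑ (λ y → ∑ (λ x → F x y) xs) ys
∑-swap F []       ys = sym (∑-zero ys)
∑-swap F (x ∷ xs) ys =
  trans (cong (_+_ (∑ (F x) ys)) (∑-swap F xs ys)) (sym (∑-+ (F x) (λ y → ∑ (λ x' → F x' y) xs) ys))

∑-filter : ∀ {a p} {A : Set a} {P : Pred A p} (P? : Decidable P) (F : A → ℤ) (xs : List A) →
           ∑ F (filter P? xs) ≡ ∑ (λ x → if does (P? x) then F x else + 0) xs
∑-filter P? F []       = refl
∑-filter P? F (x ∷ xs) with does (P? x)
... | true  = cong (_+_ (F x)) (∑-filter P? F xs)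
... | false = trans (∑-filter P? F xs) (sym (IntP.+-identityˡ _))

length-filter : ∀ {a p} {A : Set a} {P : Pred A p} (P? : Decidable P) (xs : List A) →
                + length (filter P? xs) ≡ ∑ (λ x → if does (P? x) then + 1 else + 0) xs
length-filter P? []       = refl
length-filter P? (x ∷ xs) with does (P? x)
... | true  = cong (_+_ (+ 1)) (length-filter P? xs)
... | false = trans (length-filter P? xs) (sym (IntP.+-identityˡ _))

∑-upTo-snoc : ∀ (F : ℕ → ℤ) L → ∑ F (upTo (suc L)) ≡ ∑ F (upTo L) + F L
∑-upTo-snoc F L = begin
  ∑ F (upTo (suc L))        ≡⟨ cong (∑ F) (sym (ListP.upTo-∷ʳ L)) ⟩
  ∑ F (upTo L ++ L ∷ [])    ≡⟨ ∑-++ F (upTo L) (L ∷ []) ⟩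
  ∑ F (upTo L) + (F L + + 0) ≡⟨ cong (_+_ (∑ F (upTo L))) (IntP.+-identityʳ (F L)) ⟩
  ∑ F (upTo L) + F L        ∎
  where open ≡-Reasoning

∑-upTo-suc : ∀ (F : ℕ → ℤ) L → ∑ F (upTo (suc L)) ≡ F 0 + ∑ (F ∘ suc) (upTo L)
∑-upTo-suc F L =
  cong (_+_ (F 0)) (trans (cong (∑ F) (sym (ListP.map-upTo suc L))) (∑-map F suc (upTo L)))

∑-upTo-cong : ∀ L (F G : ℕ → ℤ) → (∀ i → i < L → F i ≡ G i) → ∑ F (upTo L) ≡ ∑ G (upTo L)
∑-upTo-cong zero    F G e = refl
∑-upTo-cong (suc L) F G e = begin
  ∑ F (upTo (suc L)) ≡⟨ ∑-upTo-snoc F L ⟩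
  ∑ F (upTo L) + F L ≡⟨ cong₂ _+_ (∑-upTo-cong L F G (λ i i<L → e i (ℕP.m<n⇒m<1+n i<L))) (e L ℕP.≤-refl) ⟩
  ∑ G (upTo L) + G L ≡⟨ sym (∑-upTo-snoc G L) ⟩
  ∑ G (upTo (suc L)) ∎
  where open ≡-Reasoning

-- Whether block j is open (false beyond the last block).
isOpen : List Bool → ℕ → Bool
isOpen []       _       = false
isOpen (m ∷ ms) zero    = m
isOpen (m ∷ ms) (suc j) = isOpen ms j

openBlock : List Bool → ℕ → List Bool
openBlock []       _       = []
openBlock (m ∷ ms) zero    = true ∷ ms
openBlock (m ∷ ms) (suc j) = m ∷ openBlock ms j

#open : List Bool → ℕ
#open []           = 0
#open (true ∷ ms)  = suc (#open ms)
#open (false ∷ ms) = #open ms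

openCount≡#open : ∀ (w : List ℕ) ms → openCount (w , ms) ≡ #open ms
openCount≡#open w []           = refl
openCount≡#open w (true ∷ ms)  = cong suc (openCount≡#open w ms)
openCount≡#open w (false ∷ ms) = openCount≡#open w ms

#open-snoc : ∀ ms b → #open (ms ∷ʳ b) ≡ (if b then suc (#open ms) else #open ms)
#open-snoc []           true  = refl
#open-snoc []           false = refl
#open-snoc (true ∷ ms)  b     = trans (cong suc (#open-snoc ms b)) (lift-suc b)
  where
  lift-suc : ∀ b → suc (if b then suc (#open ms) else #open ms) ≡ (if b then suc (suc (#open ms)) else suc (#open ms))
  lift-suc true  = refl
  lift-suc false = refl
#open-snoc (false ∷ ms) b     = #open-snoc ms b

#open-openBlock : ∀ ms j → isOpen ms j ≡ false → j < length ms → #open (openBlock ms j) ≡ suc (#open ms)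
#open-openBlock (false ∷ ms) zero    _      _         = refl
#open-openBlock (true ∷ ms)  (suc j) closed (s≤s j<L) = cong suc (#open-openBlock ms j closed j<L)
#open-openBlock (false ∷ ms) (suc j) closed (s≤s j<L) = #open-openBlock ms j closed j<L

∑-open-blocks : ∀ ms (c : ℤ) → ∑ (λ j → if isOpen ms j then c else + 0) (upTo (length ms)) ≡ + #open ms * c
∑-open-blocks []           c = refl
∑-open-blocks (true ∷ ms)  c =
  trans (∑-upTo-suc (λ j → if isOpen (true ∷ ms) j then c else + 0) (length ms))
        (trans (cong (_+_ c) (∑-open-blocks ms c)) (one-more c (+ #open ms)))
  where
  one-more : ∀ c o → c + o * c ≡ (+ 1 + o) * c
  one-more = solve-∀
∑-open-blocks (false ∷ ms) c =
  trans (∑-upTo-suc (λ j → if isOpen (false ∷ ms) j then c else + 0) (length ms))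
        (trans (IntP.+-identityˡ _) (∑-open-blocks ms c))

∑-markings-suc : ∀ (F : List Bool → ℤ) L →
                 ∑ F (markings (suc L)) ≡ ∑ (F ∘ (true ∷_)) (markings L) + ∑ (F ∘ (false ∷_)) (markings L)
∑-markings-suc F L =
  trans (∑-concatMap F (λ b → map (b ∷_) (markings L)) (true ∷ false ∷ []))
        (cong₂ _+_ (∑-map F (true ∷_) (markings L))
                   (trans (IntP.+-identityʳ _) (∑-map F (false ∷_) (markings L))))

∑-markings-snoc : ∀ L (F : List Bool → ℤ) →
                  ∑ F (markings (suc L)) ≡ ∑ (λ ms → F (ms ∷ʳ true) + F (ms ∷ʳ false)) (markings L)
∑-markings-snoc zero    F = trans (cong (_+_ (F (true ∷ []))) (IntP.+-identityʳ _)) (sym (IntP.+-identityʳ _))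
∑-markings-snoc (suc L) F =
  trans (∑-markings-suc F (suc L))
  (trans (cong₂ _+_ (∑-markings-snoc L (F ∘ (true ∷_))) (∑-markings-snoc L (F ∘ (false ∷_))))
         (sym (∑-markings-suc _ L)))

∑-markings-cong : ∀ L (F G : List Bool → ℤ) → (∀ ms → length ms ≡ L → F ms ≡ G ms) →
                  ∑ F (markings L) ≡ ∑ G (markings L)
∑-markings-cong zero    F G e = cong (_+ + 0) (e [] refl)
∑-markings-cong (suc L) F G e =
  trans (∑-markings-suc F L)
  (trans (cong₂ _+_ (∑-markings-cong L _ _ (λ ms l → e (true ∷ ms) (cong suc l)))
                    (∑-markings-cong L _ _ (λ ms l → e (false ∷ ms) (cong suc l))))
         (sym (∑-markings-suc G L)))

-- Opening block j is a bijection from the markings in which j is closed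
-- onto those in which j is open.
∑-markings-reopen : ∀ L j (G : List Bool → ℤ) → j < L →
  ∑ (λ ms → if isOpen ms j then + 0 else G (openBlock ms j)) (markings L) ≡
  ∑ (λ ms → if isOpen ms j then G ms else + 0) (markings L)
∑-markings-reopen (suc L) zero    G _ =
  trans (∑-markings-suc (λ ms → if isOpen ms 0 then + 0 else G (openBlock ms 0)) L)
  (trans (IntP.+-comm (∑ (λ _ → + 0) (markings L)) (∑ (G ∘ (true ∷_)) (markings L)))
         (sym (∑-markings-suc (λ ms → if isOpen ms 0 then G ms else + 0) L)))
∑-markings-reopen (suc L) (suc j) G (s≤s j<L) =
  trans (∑-markings-suc _ L)
  (trans (cong₂ _+_ (∑-markings-reopen L j (G ∘ (true ∷_)) j<L) (∑-markings-reopen L j (G ∘ (false ∷_)) j<L))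
         (sym (∑-markings-suc _ L)))

≡ᵇ-refl : ∀ n → (n ≡ᵇ n) ≡ true
≡ᵇ-refl n = Equivalence.to BoolP.T-≡ (ℕP.≡⇒≡ᵇ n n refl)

≡ᵇ-true⇒≡ : ∀ {m n} → (m ≡ᵇ n) ≡ true → m ≡ n
≡ᵇ-true⇒≡ {m} {n} e = ℕP.≡ᵇ⇒≡ m n (Equivalence.from BoolP.T-≡ e)

≡ᵇ-false⇒≢ : ∀ {m n} → (m ≡ᵇ n) ≡ false → m ≢ n
≡ᵇ-false⇒≢ {m} e refl with () ← trans (sym (≡ᵇ-refl m)) e

≢⇒≡ᵇ-false : ∀ {m n} → m ≢ n → (m ≡ᵇ n) ≡ false
≢⇒≡ᵇ-false {m} {n} m≢n with m ≡ᵇ n in e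
... | false = refl
... | true  = ⊥-elim (m≢n (≡ᵇ-true⇒≡ e))

≤ᵇ-true⇒≤ : ∀ {m n} → (m ≤ᵇ n) ≡ true → m ≤ n
≤ᵇ-true⇒≤ {m} {n} e = ℕP.≤ᵇ⇒≤ m n (Equivalence.from BoolP.T-≡ e)

≤⇒≤ᵇ-true : ∀ {m n} → m ≤ n → (m ≤ᵇ n) ≡ true
≤⇒≤ᵇ-true m≤n = Equivalence.to BoolP.T-≡ (ℕP.≤⇒≤ᵇ m≤n)

>⇒≤ᵇ-false : ∀ {m n} → n < m → (m ≤ᵇ n) ≡ false
>⇒≤ᵇ-false {m} {n} n<m with m ≤ᵇ n in e
... | false = refl
... | true  = ⊥-elim (ℕP.<⇒≱ n<m (≤ᵇ-true⇒≤ e))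

next : ℕ → ℕ → ℕ
next k x = if x ≡ᵇ k then suc k else k

next≤suc : ∀ k x → next k x ≤ suc k
next≤suc k x with x ≡ᵇ k
... | true  = ℕP.≤-refl
... | false = ℕP.n≤1+n k

<next : ∀ {k x} → x ≤ k → x < next k x
<next {k} {x} x≤k with x ≡ᵇ k in e
... | true  = s≤s x≤k
... | false = ℕP.≤∧≢⇒< x≤k (≡ᵇ-false⇒≢ e)

-- rgs k n lists the words of length n that are valid continuations when
-- k blocks already exist, generated letter by letter without filtering.
rgs : ℕ → ℕ → List (List ℕ)
rgs k zero    = [] ∷ []
rgs k (suc n) = concatMap (λ x → map (x ∷_) (rgs (next k x) n)) (upTo (suc k))

∑-rgs-unfold : ∀ k n (F : List ℕ → ℤ) →
               ∑ F (rgs k (suc n)) ≡ ∑ (λ x → ∑ (F ∘ (x ∷_)) (rgs (next k x) n)) (upTo (suc k))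
∑-rgs-unfold k n F =
  trans (∑-concatMap F (λ x → map (x ∷_) (rgs (next k x) n)) (upTo (suc k)))
        (∑-cong (upTo (suc k)) (λ x → ∑-map F (x ∷_) (rgs (next k x) n)))

∑-rgs-cong : ∀ n k (F G : List ℕ → ℤ) → (∀ w → length w ≡ n → rgsOK k w ≡ true → F w ≡ G w) →
             ∑ F (rgs k n) ≡ ∑ G (rgs k n)
∑-rgs-cong zero    k F G e = cong (_+ + 0) (e [] refl refl)
∑-rgs-cong (suc n) k F G e =
  trans (∑-rgs-unfold k n F)
  (trans (∑-upTo-cong (suc k) _ _ (λ x x<1+k →
            ∑-rgs-cong n (next k x) (F ∘ (x ∷_)) (G ∘ (x ∷_)) (λ w l valid →
              e (x ∷ w) (cong suc l)
                (trans (cong (_∧ rgsOK (next k x) w) (≤⇒≤ᵇ-true (ℕP.≤-pred x<1+k))) valid))))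
         (sym (∑-rgs-unfold k n G)))

∑-rgs-suc : ∀ n k (F : List ℕ → ℤ) →
            ∑ F (rgs k (suc n)) ≡ ∑ (λ w → ∑ (λ x → F (w ++ x ∷ [])) (upTo (suc (nBlocksFrom k w)))) (rgs k n)
∑-rgs-suc zero    k F =
  trans (∑-rgs-unfold k 0 F)
  (trans (∑-cong (upTo (suc k)) (λ x → IntP.+-identityʳ (F (x ∷ [])))) (sym (IntP.+-identityʳ _)))
∑-rgs-suc (suc n) k F =
  trans (∑-rgs-unfold k (suc n) F)
  (trans (∑-cong (upTo (suc k)) (λ x → ∑-rgs-suc n (next k x) (F ∘ (x ∷_))))
         (sym (∑-rgs-unfold k n _)))

∑-upTo-truncate : ∀ k (F : ℕ → ℤ) N → suc k ≤ N →
                  ∑ (λ x → if x ≤ᵇ k then F x else + 0) (upTo N) ≡ ∑ F (upTo (suc k))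
∑-upTo-truncate k F (suc N) (s≤s k≤N) with k ℕ.≟ N
... | yes refl = ∑-upTo-cong (suc k) _ _ (λ i i<1+k →
                   cong (λ b → if b then F i else + 0) (≤⇒≤ᵇ-true (ℕP.≤-pred i<1+k)))
... | no  k≢N  = begin
  ∑ F≤k (upTo (suc N))                            ≡⟨ ∑-upTo-snoc F≤k N ⟩
  ∑ F≤k (upTo N) + (if N ≤ᵇ k then F N else + 0) ≡⟨ cong (λ b → ∑ F≤k (upTo N) + (if b then F N else + 0)) (>⇒≤ᵇ-false k<N) ⟩
  ∑ F≤k (upTo N) + + 0                            ≡⟨ IntP.+-identityʳ _ ⟩
  ∑ F≤k (upTo N)                                  ≡⟨ ∑-upTo-truncate k F N k<N ⟩
  ∑ F (upTo (suc k))                              ∎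
  where
  open ≡-Reasoning
  F≤k : ℕ → ℤ
  F≤k x = if x ≤ᵇ k then F x else + 0
  k<N : k < N
  k<N = ℕP.≤∧≢⇒< k≤N k≢N

∑-valid-words : ∀ m k N (F : List ℕ → ℤ) → k ℕ.+ m ≤ N →
  ∑ (λ w → if does (rgsOK k w Bool.≟ true) then F w else + 0) (words N m) ≡ ∑ F (rgs k m)
∑-valid-words zero    k N F _  = refl
∑-valid-words (suc m) k N F le =
  trans (∑-concatMap _ (λ x → map (x ∷_) (words N m)) (upTo N))
  (trans (∑-cong (upTo N) (λ x → trans (∑-map _ (x ∷_) (words N m)) (first-letter x)))
  (trans (∑-upTo-truncate k _ N (ℕP.≤-trans (ℕP.m≤m+n (suc k) m) k+1+m≤N))
         (sym (∑-rgs-unfold k m F))))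
  where
  k+1+m≤N : suc k ℕ.+ m ≤ N
  k+1+m≤N = subst (_≤ N) (ℕP.+-suc k m) le
  first-letter : ∀ x →
    ∑ (λ w → if does (rgsOK k (x ∷ w) Bool.≟ true) then F (x ∷ w) else + 0) (words N m) ≡
    (if x ≤ᵇ k then ∑ (F ∘ (x ∷_)) (rgs (next k x) m) else + 0)
  first-letter x with x ≤ᵇ k
  ... | true  = ∑-valid-words m (next k x) N (F ∘ (x ∷_)) (ℕP.≤-trans (ℕP.+-monoˡ-≤ m (next≤suc k x)) k+1+m≤N)
  ... | false = ∑-zero (words N m)

nBlocksFrom-++ : ∀ k xs ys → nBlocksFrom k (xs ++ ys) ≡ nBlocksFrom (nBlocksFrom k xs) ys
nBlocksFrom-++ k []       ys = refl
nBlocksFrom-++ k (x ∷ xs) ys = nBlocksFrom-++ (next k x) xs ys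

nBlocksFrom-mono : ∀ k w → k ≤ nBlocksFrom k w
nBlocksFrom-mono k []       = ℕP.≤-refl
nBlocksFrom-mono k (x ∷ xs) with x ≡ᵇ k
... | true  = ℕP.≤-trans (ℕP.n≤1+n k) (nBlocksFrom-mono (suc k) xs)
... | false = nBlocksFrom-mono k xs

rgsOK-∷ : ∀ {k x xs} → rgsOK k (x ∷ xs) ≡ true → x ≤ k × rgsOK (next k x) xs ≡ true
rgsOK-∷ {k} {x} valid with x ≤ᵇ k in e
... | true = ≤ᵇ-true⇒≤ e , valid

occurs : ℕ → List ℕ → Bool
occurs j []       = false
occurs j (x ∷ xs) = (x ≡ᵇ j) ∨ occurs j xs

occurs-block : ∀ k w j → rgsOK k w ≡ true → k ≤ j → j < nBlocksFrom k w → occurs j w ≡ true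
occurs-block k []       j _     k≤j j<k = ⊥-elim (ℕP.<⇒≱ j<k k≤j)
occurs-block k (x ∷ xs) j valid k≤j j<ℓ with rgsOK-∷ {k} {x} {xs} valid
... | x≤k , valid′ with x ≡ᵇ k in e
...   | false = trans (cong ((x ≡ᵇ j) ∨_) (occurs-block k xs j valid′ k≤j j<ℓ)) (BoolP.∨-zeroʳ _)
...   | true with j ℕ.≟ k
...     | yes refl = cong (_∨ occurs j xs) (subst (λ y → (y ≡ᵇ j) ≡ true) (sym (≡ᵇ-true⇒≡ {x} {k} e)) (≡ᵇ-refl j))
...     | no  j≢k  = trans (cong ((x ≡ᵇ j) ∨_)
                             (occurs-block (suc k) xs j valid′ (ℕP.≤∧≢⇒< k≤j (j≢k ∘ sym)) j<ℓ))
                           (BoolP.∨-zeroʳ _)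

occurs-beyond : ∀ k w j → rgsOK k w ≡ true → nBlocksFrom k w ≤ j → occurs j w ≡ false
occurs-beyond k []       j _     _   = refl
occurs-beyond k (x ∷ xs) j valid ℓ≤j with rgsOK-∷ {k} {x} {xs} valid
... | x≤k , valid′ = trans (cong (_∨ occurs j xs) (≢⇒≡ᵇ-false {x} {j} (λ { refl → ℕP.<-irrefl refl x<j })))
                           (occurs-beyond (next k x) xs j valid′ ℓ≤j)
  where
  x<j : x < j
  x<j = ℕP.<-≤-trans (<next x≤k) (ℕP.≤-trans (nBlocksFrom-mono (next k x) xs) ℓ≤j)

minFrom-++ : ∀ j pos w ys → occurs j w ≡ true → minFrom j pos (w ++ ys) ≡ minFrom j pos w
minFrom-++ j pos (x ∷ xs) ys occ with x ≡ᵇ j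
... | true  = refl
... | false = minFrom-++ j (suc pos) xs ys occ

minFrom-new : ∀ j pos w → occurs j w ≡ false → minFrom j pos (w ++ j ∷ []) ≡ pos ℕ.+ length w
minFrom-new j pos []       _   rewrite ≡ᵇ-refl j = sym (ℕP.+-identityʳ pos)
minFrom-new j pos (x ∷ xs) occ with x ≡ᵇ j
... | false = trans (minFrom-new j (suc pos) xs occ) (sym (ℕP.+-suc pos (length xs)))

maxFrom-other : ∀ j pos w x → (x ≡ᵇ j) ≡ false → maxFrom j pos (w ++ x ∷ []) ≡ maxFrom j pos w
maxFrom-other j pos []       x x≢j rewrite x≢j = refl
maxFrom-other j pos (y ∷ ys) x x≢j with y ≡ᵇ j
... | true  = cong (pos ⊔_) (maxFrom-other j (suc pos) ys x x≢j)
... | false = maxFrom-other j (suc pos) ys x x≢j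

maxFrom-last : ∀ j pos w → maxFrom j pos (w ++ j ∷ []) ≡ pos ℕ.+ length w
maxFrom-last j pos []       rewrite ≡ᵇ-refl j = trans (ℕP.⊔-identityʳ pos) (sym (ℕP.+-identityʳ pos))
maxFrom-last j pos (y ∷ ys) with y ≡ᵇ j
... | true  = trans (cong (pos ⊔_) (maxFrom-last j (suc pos) ys))
              (trans (ℕP.m≤n⇒m⊔n≡n (ℕP.≤-trans (ℕP.n≤1+n pos) (ℕP.m≤m+n (suc pos) (length ys))))
                     (sym (ℕP.+-suc pos (length ys))))
... | false = trans (maxFrom-last j (suc pos) ys) (sym (ℕP.+-suc pos (length ys)))

-- Sums over the blocks f 0, …, f (L-1) of a term depending on the block and
-- its mark; the closed-maximum part of d̃ has this shape.
blockSum : (ℕ → ℕ) → (ℕ → Bool → ℤ) → ℕ → List Bool → ℤ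
blockSum f H L ms = ∑ (λ jm → H (proj₁ jm) (proj₂ jm)) (zip (applyUpTo f L) ms)

blockSum-cong : ∀ L f H H′ ms → length ms ≡ L →
  (∀ i → i < L → H (f i) (isOpen ms i) ≡ H′ (f i) (isOpen ms i)) → blockSum f H L ms ≡ blockSum f H′ L ms
blockSum-cong zero    f H H′ []       _ _ = refl
blockSum-cong (suc L) f H H′ (m ∷ ms) l e =
  cong₂ _+_ (e 0 (s≤s z≤n)) (blockSum-cong L (f ∘ suc) H H′ ms (ℕP.suc-injective l) (λ i i<L → e (suc i) (s≤s i<L)))

blockSum-openBlock : ∀ L f H H′ ms j c → length ms ≡ L → j < L →
  (∀ i → i < L → i ≢ j → H (f i) (isOpen ms i) ≡ H′ (f i) (isOpen ms i)) →
  H (f j) (isOpen ms j) ≡ H′ (f j) true + c →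
  blockSum f H L ms ≡ blockSum f H′ L (openBlock ms j) + c
blockSum-openBlock (suc L) f H H′ (m ∷ ms) zero c l _ e ej =
  trans (cong₂ _+_ ej (blockSum-cong L (f ∘ suc) H H′ ms (ℕP.suc-injective l) (λ i i<L → e (suc i) (s≤s i<L) λ ())))
        (swap₂₃ (H′ (f 0) true) c (blockSum (f ∘ suc) H′ L ms))
  where
  swap₂₃ : ∀ a b c → a + b + c ≡ a + c + b
  swap₂₃ = solve-∀
blockSum-openBlock (suc L) f H H′ (m ∷ ms) (suc j) c l (s≤s j<L) e ej =
  trans (cong₂ _+_ (e 0 (s≤s z≤n) (λ ()))
          (blockSum-openBlock L (f ∘ suc) H H′ ms j c (ℕP.suc-injective l) j<L
            (λ i i<L i≢j → e (suc i) (s≤s i<L) (i≢j ∘ ℕP.suc-injective)) ej))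
        (sym (IntP.+-assoc (H′ (f 0) m) _ c))

zip-∷ʳ : ∀ {A B : Set} (xs : List A) (ys : List B) a b → length xs ≡ length ys →
         zip (xs ∷ʳ a) (ys ∷ʳ b) ≡ zip xs ys ∷ʳ (a , b)
zip-∷ʳ []       []       a b _ = refl
zip-∷ʳ (x ∷ xs) (y ∷ ys) a b l = cong ((x , y) ∷_) (zip-∷ʳ xs ys a b (ℕP.suc-injective l))

blockSum-snoc : ∀ L H ms b → length ms ≡ L → blockSum id H (suc L) (ms ∷ʳ b) ≡ blockSum id H L ms + H L b
blockSum-snoc L H ms b l = begin
  ∑ H′ (zip (upTo (suc L)) (ms ∷ʳ b))       ≡⟨ cong (λ js → ∑ H′ (zip js (ms ∷ʳ b))) (sym (ListP.upTo-∷ʳ L)) ⟩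
  ∑ H′ (zip (upTo L ∷ʳ L) (ms ∷ʳ b))        ≡⟨ cong (∑ H′) (zip-∷ʳ (upTo L) ms L b (trans (ListP.length-upTo L) (sym l))) ⟩
  ∑ H′ (zip (upTo L) ms ∷ʳ (L , b))         ≡⟨ ∑-++ H′ (zip (upTo L) ms) ((L , b) ∷ []) ⟩
  blockSum id H L ms + (H L b + + 0)        ≡⟨ cong (_+_ (blockSum id H L ms)) (IntP.+-identityʳ (H L b)) ⟩
  blockSum id H L ms + H L b                ∎
  where
  open ≡-Reasoning
  H′ : ℕ × Bool → ℤ
  H′ jm = H (proj₁ jm) (proj₂ jm)

maxIfClosed : List ℕ → ℕ → Bool → ℤ
maxIfClosed w j m = if m then + 0 else + maxBlock w j

closedMax : List ℕ → ℕ → List Bool → ℤ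
closedMax w = blockSum id (maxIfClosed w)

minSum : List ℕ → ℕ → ℤ
minSum w L = ∑ (λ j → + minBlock w j) (upTo L)

dtilde-unfold : ∀ n w ms →
  dtilde n (w , ms) ≡ closedMax w (nBlocks w) ms - minSum w (nBlocks w) + + nBlocks w + + n * (+ #open ms - + 1)
dtilde-unfold n w ms =
  cong (λ o → closedMax w (nBlocks w) ms - minSum w (nBlocks w) + + nBlocks w + + n * (+ o - + 1)) (openCount≡#open w ms)

dtilde-unfoldAt : ∀ n w ms N → nBlocks w ≡ N →
  dtilde n (w , ms) ≡ closedMax w N ms - minSum w N + + N + + n * (+ #open ms - + 1)
dtilde-unfoldAt n w ms N refl = dtilde-unfold n w ms

module AppendLetter (w : List ℕ) (valid : rgsOK 0 w ≡ true) where

  L n : ℕ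
  L = nBlocks w
  n = length w

  nBlocks-new : nBlocks (w ++ L ∷ []) ≡ suc L
  nBlocks-new = trans (nBlocksFrom-++ 0 w (L ∷ [])) (cong (λ b → if b then suc L else L) (≡ᵇ-refl L))

  nBlocks-old : ∀ x → x < L → nBlocks (w ++ x ∷ []) ≡ L
  nBlocks-old x x<L = trans (nBlocksFrom-++ 0 w (x ∷ []))
                            (cong (λ b → if b then suc L else L) (≢⇒≡ᵇ-false {x} {L} (ℕP.<⇒≢ x<L)))

  minSum-old : ∀ x → minSum (w ++ x ∷ []) L ≡ minSum w L
  minSum-old x = ∑-upTo-cong L _ _ (λ i i<L → cong +_ (minFrom-++ i 1 w (x ∷ []) (occurs-block 0 w i valid z≤n i<L)))

  minSum-new : minSum (w ++ L ∷ []) (suc L) ≡ minSum w L + + suc n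
  minSum-new = trans (∑-upTo-snoc (λ j → + minBlock (w ++ L ∷ []) j) L)
                     (cong₂ _+_ (minSum-old L) (cong +_ (minFrom-new L 1 w (occurs-beyond 0 w L valid ℕP.≤-refl))))

  maxIfClosed-other : ∀ x i m → i ≢ x → maxIfClosed (w ++ x ∷ []) i m ≡ maxIfClosed w i m
  maxIfClosed-other x i m i≢x = cong (λ z → if m then + 0 else + z) (maxFrom-other i 1 w x (≢⇒≡ᵇ-false (i≢x ∘ sym)))

  dtilde-new-block : ∀ ms b → length ms ≡ L →
    dtilde (suc n) (w ++ L ∷ [] , ms ∷ʳ b) ≡ dtilde n (w , ms) + + #open ms
  dtilde-new-block ms b l = begin
    dtilde (suc n) (w′ , ms ∷ʳ b)
      ≡⟨ dtilde-unfoldAt (suc n) w′ (ms ∷ʳ b) (suc L) nBlocks-new ⟩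
    closedMax w′ (suc L) (ms ∷ʳ b) - minSum w′ (suc L) + + suc L + + suc n * (+ #open (ms ∷ʳ b) - + 1)
      ≡⟨ cong₂ (λ cm am → cm - am + + suc L + + suc n * (+ #open (ms ∷ʳ b) - + 1)) closedMax-new minSum-new ⟩
    closedMax w L ms + maxIfClosed w′ L b - (minSum w L + + suc n) + + suc L + + suc n * (+ #open (ms ∷ʳ b) - + 1)
      ≡⟨ by-mark b ⟩
    closedMax w L ms - minSum w L + + L + + n * (+ #open ms - + 1) + + #open ms
      ≡⟨ cong (_+ + #open ms) (sym (dtilde-unfold n w ms)) ⟩
    dtilde n (w , ms) + + #open ms ∎
    where
    open ≡-Reasoning
    w′ : List ℕ
    w′ = w ++ L ∷ []
    closedMax-new : closedMax w′ (suc L) (ms ∷ʳ b) ≡ closedMax w L ms + maxIfClosed w′ L b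
    closedMax-new = trans (blockSum-snoc L (maxIfClosed w′) ms b l)
      (cong (_+ maxIfClosed w′ L b) (blockSum-cong L id _ _ ms l (λ i i<L → maxIfClosed-other L i _ (ℕP.<⇒≢ i<L))))
    open-case : ∀ cm am L n o → cm + + 0 - (am + (+ 1 + n)) + (+ 1 + L) + (+ 1 + n) * ((o + + 1) - + 1)
                                ≡ cm - am + L + n * (o - + 1) + o
    open-case = solve-∀
    closed-case : ∀ cm am L n o → cm + (+ 1 + n) - (am + (+ 1 + n)) + (+ 1 + L) + (+ 1 + n) * (o - + 1)
                                  ≡ cm - am + L + n * (o - + 1) + o
    closed-case = solve-∀
    by-mark : ∀ b → closedMax w L ms + maxIfClosed w′ L b - (minSum w L + + suc n) + + suc L + + suc n * (+ #open (ms ∷ʳ b) - + 1)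
                    ≡ closedMax w L ms - minSum w L + + L + + n * (+ #open ms - + 1) + + #open ms
    by-mark true  rewrite #open-snoc ms true =
      trans (cong (λ o → closedMax w L ms + + 0 - (minSum w L + + suc n) + + suc L + + suc n * (o - + 1))
                  (IntP.+-comm (+ 1) (+ #open ms)))
            (open-case (closedMax w L ms) (minSum w L) (+ L) (+ n) (+ #open ms))
    by-mark false rewrite #open-snoc ms false | maxFrom-last L 1 w =
      closed-case (closedMax w L ms) (minSum w L) (+ L) (+ n) (+ #open ms)

  dtilde-into-open : ∀ ms x → x < L → length ms ≡ L → isOpen ms x ≡ true →
    dtilde (suc n) (w ++ x ∷ [] , ms) ≡ dtilde n (w , ms) + (+ #open ms - + 1)
  dtilde-into-open ms x x<L l x-open = begin
    dtilde (suc n) (w ++ x ∷ [] , ms)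
      ≡⟨ dtilde-unfoldAt (suc n) (w ++ x ∷ []) ms L (nBlocks-old x x<L) ⟩
    closedMax (w ++ x ∷ []) L ms - minSum (w ++ x ∷ []) L + + L + + suc n * (+ #open ms - + 1)
      ≡⟨ cong₂ (λ cm am → cm - am + + L + + suc n * (+ #open ms - + 1))
               (blockSum-cong L id _ _ ms l same-max) (minSum-old x) ⟩
    closedMax w L ms - minSum w L + + L + + suc n * (+ #open ms - + 1)
      ≡⟨ one-more-element (closedMax w L ms) (minSum w L) (+ L) (+ n) (+ #open ms) ⟩
    closedMax w L ms - minSum w L + + L + + n * (+ #open ms - + 1) + (+ #open ms - + 1)
      ≡⟨ cong (_+ (+ #open ms - + 1)) (sym (dtilde-unfold n w ms)) ⟩
    dtilde n (w , ms) + (+ #open ms - + 1) ∎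
    where
    open ≡-Reasoning
    -- block x is open, so its maximum does not enter d̃
    same-max : ∀ i → i < L → maxIfClosed (w ++ x ∷ []) i (isOpen ms i) ≡ maxIfClosed w i (isOpen ms i)
    same-max i i<L with i ℕ.≟ x
    ... | yes refl rewrite x-open = refl
    ... | no  i≢x  = maxIfClosed-other x i _ i≢x
    one-more-element : ∀ cm am L n o → cm - am + L + (+ 1 + n) * (o - + 1) ≡ cm - am + L + n * (o - + 1) + (o - + 1)
    one-more-element = solve-∀

  -- (d): n+1 joins a closed block x; compared with the marking in which x
  -- is open, the maximum n+1 of x now enters d̃.
  dtilde-into-closed : ∀ ms x → x < L → length ms ≡ L → isOpen ms x ≡ false →
    dtilde (suc n) (w ++ x ∷ [] , ms) ≡ dtilde n (w , openBlock ms x) + + #open ms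
  dtilde-into-closed ms x x<L l x-closed = begin
    dtilde (suc n) (w ++ x ∷ [] , ms)
      ≡⟨ dtilde-unfoldAt (suc n) (w ++ x ∷ []) ms L (nBlocks-old x x<L) ⟩
    closedMax (w ++ x ∷ []) L ms - minSum (w ++ x ∷ []) L + + L + + suc n * (+ #open ms - + 1)
      ≡⟨ cong₂ (λ cm am → cm - am + + L + + suc n * (+ #open ms - + 1))
               (blockSum-openBlock L id _ _ ms x (+ suc n) l x<L (λ i _ i≢x → maxIfClosed-other x i _ i≢x) new-max)
               (minSum-old x) ⟩
    closedMax w L ms′ + + suc n - minSum w L + + L + + suc n * (+ #open ms - + 1)
      ≡⟨ reopen (closedMax w L ms′) (minSum w L) (+ L) (+ n) (+ #open ms) ⟩
    closedMax w L ms′ - minSum w L + + L + + n * (+ suc (#open ms) - + 1) + + #open ms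
      ≡⟨ cong (λ o → closedMax w L ms′ - minSum w L + + L + + n * (+ o - + 1) + + #open ms)
              (sym (#open-openBlock ms x x-closed (subst (x <_) (sym l) x<L))) ⟩
    closedMax w L ms′ - minSum w L + + L + + n * (+ #open ms′ - + 1) + + #open ms
      ≡⟨ cong (_+ + #open ms) (sym (dtilde-unfold n w ms′)) ⟩
    dtilde n (w , ms′) + + #open ms ∎
    where
    open ≡-Reasoning
    ms′ : List Bool
    ms′ = openBlock ms x
    new-max : maxIfClosed (w ++ x ∷ []) x (isOpen ms x) ≡ maxIfClosed w x true + + suc n
    new-max rewrite x-closed = cong +_ (maxFrom-last x 1 w)
    reopen : ∀ cm am L n o → cm + (+ 1 + n) - am + L + (+ 1 + n) * (o - + 1) ≡ cm - am + L + n * ((+ 1 + o) - + 1) + o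
    reopen = solve-∀

indicator : ℤ → ℤ → ℕ → ℤ → ℤ
indicator A B o d = if does ((+ o Int.≟ A) ×-dec (d Int.≟ B)) then + 1 else + 0

equal-differences : ∀ {x y x′ y′} → x - y ≡ x′ - y′ → y ≡ x → y′ ≡ x′
equal-differences {x} {y} {x′} {y′} e y≡x =
  sym (IntP.i-j≡0⇒i≡j x′ y′ (trans (sym e) (IntP.i≡j⇒i-j≡0 (sym y≡x))))

indicator-shift : ∀ A B A′ B′ o o′ d d′ → A - + o ≡ A′ - + o′ → (+ o ≡ A → B - d ≡ B′ - d′) →
                  indicator A B o d ≡ indicator A′ B′ o′ d′
indicator-shift A B A′ B′ o o′ d d′ eA eB =
  cong (λ b → if b then + 1 else + 0)
       (does-⇔ (mk⇔ to from) ((+ o Int.≟ A) ×-dec (d Int.≟ B)) ((+ o′ Int.≟ A′) ×-dec (d′ Int.≟ B′)))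
  where
  to : + o ≡ A × d ≡ B → + o′ ≡ A′ × d′ ≡ B′
  to (o≡A , d≡B) = equal-differences eA o≡A , equal-differences (eB o≡A) d≡B
  from : + o′ ≡ A′ × d′ ≡ B′ → + o ≡ A × d ≡ B
  from (o′≡A′ , d′≡B′) = o≡A , equal-differences (sym (eB o≡A)) d′≡B′
    where
    o≡A : + o ≡ A
    o≡A = equal-differences (sym eA) o′≡A′

-- When the indicator is nonzero, o = A.
indicator-weight : ∀ A B o d → + o * indicator A B o d ≡ A * indicator A B o d
indicator-weight A B o d with + o Int.≟ A
... | yes o≡A = cong (_* (if does (d Int.≟ B) then + 1 else + 0)) o≡A
... | no  _   = trans (IntP.*-zeroʳ (+ o)) (sym (IntP.*-zeroʳ A))

indicator-new-open : ∀ A B o d → indicator A B (suc o) (d + + o) ≡ indicator (A - + 1) (B - A + + 1) o d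
indicator-new-open A B o d = indicator-shift A B (A - + 1) (B - A + + 1) (suc o) o (d + + o) d
  (shiftA A (+ o)) (λ { refl → shiftB B d (+ o) })
  where
  shiftA : ∀ A o → A - (+ 1 + o) ≡ A - + 1 - o
  shiftA = solve-∀
  shiftB : ∀ B d o → B - (d + o) ≡ B - (+ 1 + o) + + 1 - d
  shiftB = solve-∀

indicator-new-closed : ∀ A B o d → indicator A B o (d + + o) ≡ indicator A (B - A) o d
indicator-new-closed A B o d = indicator-shift A B A (B - A) o o (d + + o) d
  refl (λ { refl → shiftB B d (+ o) })
  where
  shiftB : ∀ B d o → B - (d + o) ≡ B - o - d
  shiftB = solve-∀

indicator-into-open : ∀ A B o d → indicator A B o (d + (+ o - + 1)) ≡ indicator A (B - A + + 1) o d
indicator-into-open A B o d = indicator-shift A B A (B - A + + 1) o o (d + (+ o - + 1)) d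
  refl (λ { refl → shiftB B d (+ o) })
  where
  shiftB : ∀ B d o → B - (d + (o - + 1)) ≡ B - o + + 1 - d
  shiftB = solve-∀

indicator-into-closed : ∀ A B o d → indicator A B o (d + + o) ≡ indicator (A + + 1) (B - A) (suc o) d
indicator-into-closed A B o d = indicator-shift A B (A + + 1) (B - A) o (suc o) (d + + o) d
  (shiftA A (+ o)) (λ { refl → shiftB B d (+ o) })
  where
  shiftA : ∀ A o → A - o ≡ A + + 1 - (+ 1 + o)
  shiftA = solve-∀
  shiftB : ∀ B d o → B - (d + o) ≡ B - o - d
  shiftB = solve-∀

markedTerm : ℕ → ℤ → ℤ → List ℕ → List Bool → ℤ
markedTerm m A B w ms = indicator A B (#open ms) (dtilde m (w , ms))

wordCount : ℕ → ℤ → ℤ → List ℕ → ℤ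
wordCount m A B w = ∑ (markedTerm m A B w) (markings (nBlocks w))

f-as-sum : ∀ m A B → + f m A B ≡ ∑ (wordCount m A B) (rgs 0 m)
f-as-sum m A B = begin
  + f m A B
    ≡⟨ length-filter matches (markedSetPartitions m) ⟩
  ∑ hit (markedSetPartitions m)
    ≡⟨ ∑-concatMap hit (λ w → map (w ,_) (markings (nBlocks w))) (setPartitions m) ⟩
  ∑ (λ w → ∑ hit (map (w ,_) (markings (nBlocks w)))) (setPartitions m)
    ≡⟨ ∑-cong (setPartitions m) (λ w → trans (∑-map hit (w ,_) (markings (nBlocks w)))
         (∑-cong (markings (nBlocks w)) (λ ms → cong (λ o → indicator A B o (dtilde m (w , ms))) (openCount≡#open w ms)))) ⟩
  ∑ (wordCount m A B) (setPartitions m)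
    ≡⟨ ∑-filter (λ w → rgsOK 0 w Bool.≟ true) (wordCount m A B) (words m m) ⟩
  ∑ (λ w → if does (rgsOK 0 w Bool.≟ true) then wordCount m A B w else + 0) (words m m)
    ≡⟨ ∑-valid-words m 0 m (wordCount m A B) ℕP.≤-refl ⟩
  ∑ (wordCount m A B) (rgs 0 m) ∎
  where
  open ≡-Reasoning
  matches : (λ′ : MarkedSP) → Dec (+ openCount λ′ ≡ A × dtilde m λ′ ≡ B)
  matches λ′ = (+ openCount λ′ Int.≟ A) ×-dec (dtilde m λ′ Int.≟ B)
  hit : MarkedSP → ℤ
  hit λ′ = if does (matches λ′) then + 1 else + 0

if-split : ∀ b (p q : ℤ) → (if b then p else q) ≡ (if b then p else + 0) + (if b then + 0 else q)
if-split true  p q = sym (IntP.+-identityʳ p)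
if-split false p q = sym (IntP.+-identityˡ q)

if-merge : ∀ b (p q : ℤ) → (if b then p else + 0) + (if b then q else + 0) ≡ (if b then p + q else + 0)
if-merge true  p q = refl
if-merge false p q = refl

module AppendToWord (w : List ℕ) (valid : rgsOK 0 w ≡ true) (A B : ℤ) where
  open AppendLetter w valid

  extended : ℕ → ℤ
  extended x = wordCount (suc n) A B (w ++ x ∷ [])

  extended-new : extended L ≡ wordCount n (A - + 1) (B - A + + 1) w + wordCount n A (B - A) w
  extended-new = begin
    extended L
      ≡⟨ cong (λ N → ∑ term (markings N)) nBlocks-new ⟩
    ∑ term (markings (suc L))
      ≡⟨ ∑-markings-snoc L term ⟩
    ∑ (λ ms → term (ms ∷ʳ true) + term (ms ∷ʳ false)) (markings L)
      ≡⟨ ∑-markings-cong L _ _ (λ ms l → cong₂ _+_ (new-open ms l) (new-closed ms l)) ⟩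
    ∑ (λ ms → markedTerm n (A - + 1) (B - A + + 1) w ms + markedTerm n A (B - A) w ms) (markings L)
      ≡⟨ ∑-+ (markedTerm n (A - + 1) (B - A + + 1) w) (markedTerm n A (B - A) w) (markings L) ⟩
    wordCount n (A - + 1) (B - A + + 1) w + wordCount n A (B - A) w ∎
    where
    open ≡-Reasoning
    term : List Bool → ℤ
    term = markedTerm (suc n) A B (w ++ L ∷ [])
    new-open : ∀ ms → length ms ≡ L → term (ms ∷ʳ true) ≡ markedTerm n (A - + 1) (B - A + + 1) w ms
    new-open ms l = trans (cong₂ (indicator A B) (#open-snoc ms true) (dtilde-new-block ms true l))
                          (indicator-new-open A B (#open ms) (dtilde n (w , ms)))
    new-closed : ∀ ms → length ms ≡ L → term (ms ∷ʳ false) ≡ markedTerm n A (B - A) w ms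
    new-closed ms l = trans (cong₂ (indicator A B) (#open-snoc ms false) (dtilde-new-block ms false l))
                            (indicator-new-closed A B (#open ms) (dtilde n (w , ms)))

  stays : List Bool → ℤ
  stays = markedTerm n A (B - A + + 1) w

  grows : List Bool → ℤ
  grows = markedTerm n (A + + 1) (B - A) w

  -- cases (c) and (d): appending to block x only sees the markings in which
  -- x is open (for (d) after reopening x).
  extended-old : ∀ x → x < L → extended x ≡ ∑ (λ ms → if isOpen ms x then stays ms + grows ms else + 0) (markings L)
  extended-old x x<L = begin
    extended x
      ≡⟨ cong (λ N → ∑ term (markings N)) (nBlocks-old x x<L) ⟩
    ∑ term (markings L)
      ≡⟨ ∑-markings-cong L _ _ (λ ms l → trans (by-mark ms l) (if-split (isOpen ms x) _ _)) ⟩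
    ∑ (λ ms → (if isOpen ms x then stays ms else + 0) + (if isOpen ms x then + 0 else grows (openBlock ms x))) (markings L)
      ≡⟨ ∑-+ (λ ms → if isOpen ms x then stays ms else + 0) _ (markings L) ⟩
    ∑ (λ ms → if isOpen ms x then stays ms else + 0) (markings L)
      + ∑ (λ ms → if isOpen ms x then + 0 else grows (openBlock ms x)) (markings L)
      ≡⟨ cong (_+_ (∑ (λ ms → if isOpen ms x then stays ms else + 0) (markings L))) (∑-markings-reopen L x grows x<L) ⟩
    ∑ (λ ms → if isOpen ms x then stays ms else + 0) (markings L)
      + ∑ (λ ms → if isOpen ms x then grows ms else + 0) (markings L)
      ≡⟨ sym (∑-+ (λ ms → if isOpen ms x then stays ms else + 0) (λ ms → if isOpen ms x then grows ms else + 0) (markings L)) ⟩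
    ∑ (λ ms → (if isOpen ms x then stays ms else + 0) + (if isOpen ms x then grows ms else + 0)) (markings L)
      ≡⟨ ∑-cong (markings L) (λ ms → if-merge (isOpen ms x) (stays ms) (grows ms)) ⟩
    ∑ (λ ms → if isOpen ms x then stays ms + grows ms else + 0) (markings L) ∎
    where
    open ≡-Reasoning
    term : List Bool → ℤ
    term = markedTerm (suc n) A B (w ++ x ∷ [])
    by-mark : ∀ ms → length ms ≡ L → term ms ≡ (if isOpen ms x then stays ms else grows (openBlock ms x))
    by-mark ms l with isOpen ms x in mark
    ... | true  = trans (cong (indicator A B (#open ms)) (dtilde-into-open ms x x<L l mark))
                        (indicator-into-open A B (#open ms) (dtilde n (w , ms)))
    ... | false = trans (cong (indicator A B (#open ms)) (dtilde-into-closed ms x x<L l mark))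
                  (trans (indicator-into-closed A B (#open ms) (dtilde n (w , openBlock ms x)))
                         (cong (λ o → indicator (A + + 1) (B - A) o (dtilde n (w , openBlock ms x)))
                               (sym (#open-openBlock ms x mark (subst (x <_) (sym l) x<L)))))

  -- Summing (c) and (d) over the blocks: each open block contributes once,
  -- and on the relevant terms the number of open blocks is A resp. A + 1.
  extended-olds : ∑ extended (upTo L) ≡ A * wordCount n A (B - A + + 1) w + (A + + 1) * wordCount n (A + + 1) (B - A) w
  extended-olds = begin
    ∑ extended (upTo L)
      ≡⟨ ∑-upTo-cong L _ _ extended-old ⟩
    ∑ (λ x → ∑ (λ ms → openTerm x ms) (markings L)) (upTo L)
      ≡⟨ ∑-swap openTerm (upTo L) (markings L) ⟩
    ∑ (λ ms → ∑ (λ x → openTerm x ms) (upTo L)) (markings L)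
      ≡⟨ ∑-markings-cong L _ _ per-marking ⟩
    ∑ (λ ms → A * stays ms + (A + + 1) * grows ms) (markings L)
      ≡⟨ ∑-+ (λ ms → A * stays ms) (λ ms → (A + + 1) * grows ms) (markings L) ⟩
    ∑ (λ ms → A * stays ms) (markings L) + ∑ (λ ms → (A + + 1) * grows ms) (markings L)
      ≡⟨ cong₂ _+_ (∑-* A stays (markings L)) (∑-* (A + + 1) grows (markings L)) ⟩
    A * wordCount n A (B - A + + 1) w + (A + + 1) * wordCount n (A + + 1) (B - A) w ∎
    where
    open ≡-Reasoning
    openTerm : ℕ → List Bool → ℤ
    openTerm x ms = if isOpen ms x then stays ms + grows ms else + 0
    per-marking : ∀ ms → length ms ≡ L → ∑ (λ x → openTerm x ms) (upTo L) ≡ A * stays ms + (A + + 1) * grows ms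
    per-marking ms l =
      trans (cong (λ N → ∑ (λ x → openTerm x ms) (upTo N)) (sym l))
      (trans (∑-open-blocks ms (stays ms + grows ms))
      (trans (IntP.*-distribˡ-+ (+ #open ms) (stays ms) (grows ms))
             (cong₂ _+_ (indicator-weight A (B - A + + 1) (#open ms) (dtilde n (w , ms)))
                        (indicator-weight (A + + 1) (B - A) (#open ms) (dtilde n (w , ms))))))

  wordCount-append :
    ∑ extended (upTo (suc L)) ≡
      wordCount n (A - + 1) (B - A + + 1) w + wordCount n A (B - A) w
      + A * wordCount n A (B - A + + 1) w + (A + + 1) * wordCount n (A + + 1) (B - A) w
  wordCount-append =
    trans (∑-upTo-snoc extended L)
    (trans (cong₂ _+_ extended-olds extended-new)
           (rearrange (A * wordCount n A (B - A + + 1) w) ((A + + 1) * wordCount n (A + + 1) (B - A) w)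
                      (wordCount n (A - + 1) (B - A + + 1) w) (wordCount n A (B - A) w)))
    where
    rearrange : ∀ x y p q → x + y + (p + q) ≡ p + q + x + y
    rearrange = solve-∀

wordCount-append : ∀ n w → length w ≡ n → rgsOK 0 w ≡ true → ∀ A B →
  ∑ (λ x → wordCount (suc n) A B (w ++ x ∷ [])) (upTo (suc (nBlocks w))) ≡
    wordCount n (A - + 1) (B - A + + 1) w + wordCount n A (B - A) w
    + A * wordCount n A (B - A + + 1) w + (A + + 1) * wordCount n (A + + 1) (B - A) w
wordCount-append .(length w) w refl valid A B = AppendToWord.wordCount-append w valid A B

∑-recurrence-shape : ∀ {a} {X : Set a} (A : ℤ) (h₁ h₂ h₃ h₄ : X → ℤ) xs →
  ∑ (λ x → h₁ x + h₂ x + A * h₃ x + (A + + 1) * h₄ x) xs ≡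
    ∑ h₁ xs + ∑ h₂ xs + A * ∑ h₃ xs + (A + + 1) * ∑ h₄ xs
∑-recurrence-shape A h₁ h₂ h₃ h₄ xs =
  trans (∑-+ (λ x → h₁ x + h₂ x + A * h₃ x) (λ x → (A + + 1) * h₄ x) xs)
  (cong₂ _+_ (trans (∑-+ (λ x → h₁ x + h₂ x) (λ x → A * h₃ x) xs)
                    (cong₂ _+_ (∑-+ h₁ h₂ xs) (∑-* A h₃ xs)))
             (∑-* (A + + 1) h₄ xs))

recurrence : (n : ℕ) → (A B : ℤ) →
  + f (suc n) A B ≡
    + f n (A - + 1) (B - A + + 1) + + f n A (B - A)
    + A * + f n A (B - A + + 1)
    + (A + + 1) * + f n (A + + 1) (B - A)
recurrence n A B = begin
  + f (suc n) A B
    ≡⟨ f-as-sum (suc n) A B ⟩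
  ∑ (wordCount (suc n) A B) (rgs 0 (suc n))
    ≡⟨ ∑-rgs-suc n 0 (wordCount (suc n) A B) ⟩
  ∑ (λ w → ∑ (λ x → wordCount (suc n) A B (w ++ x ∷ [])) (upTo (suc (nBlocks w)))) (rgs 0 n)
    ≡⟨ ∑-rgs-cong n 0 _ _ (λ w l valid → wordCount-append n w l valid A B) ⟩
  ∑ (λ w → h₁ w + h₂ w + A * h₃ w + (A + + 1) * h₄ w) (rgs 0 n)
    ≡⟨ ∑-recurrence-shape A h₁ h₂ h₃ h₄ (rgs 0 n) ⟩
  ∑ h₁ (rgs 0 n) + ∑ h₂ (rgs 0 n) + A * ∑ h₃ (rgs 0 n) + (A + + 1) * ∑ h₄ (rgs 0 n)
    ≡⟨ sym (cong₂ _+_ (cong₂ _+_ (cong₂ _+_ (f-as-sum n (A - + 1) (B - A + + 1)) (f-as-sum n A (B - A)))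
                                 (cong (A *_) (f-as-sum n A (B - A + + 1))))
                      (cong ((A + + 1) *_) (f-as-sum n (A + + 1) (B - A)))) ⟩
  + f n (A - + 1) (B - A + + 1) + + f n A (B - A) + A * + f n A (B - A + + 1) + (A + + 1) * + f n (A + + 1) (B - A) ∎
  where
  open ≡-Reasoning
  h₁ h₂ h₃ h₄ : List ℕ → ℤ
  h₁ = wordCount n (A - + 1) (B - A + + 1)
  h₂ = wordCount n A (B - A)
  h₃ = wordCount n A (B - A + + 1)
  h₄ = wordCount n (A + + 1) (B - A)

-- The empty partition: its only marking has o = 0 and d̃ = 0.
f-empty-vanishes : (A B : ℤ) → (A , B) ≢ (+ 0 , + 0) → f 0 A B ≡ 0
f-empty-vanishes A B AB≢00 = IntP.+-injective (trans (f-as-sum 0 A B) (cong (λ z → z + + 0 + + 0) empty-term))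
  where
  empty-term : indicator A B 0 (+ 0) ≡ + 0
  empty-term with + 0 Int.≟ A | + 0 Int.≟ B
  ... | yes refl | yes refl = ⊥-elim (AB≢00 refl)
  ... | yes _    | no  _    = refl
  ... | no  _    | _        = refl

theorem4p1 : ((n : ℕ) → (A B : ℤ) →
                + f (suc n) A B ≡
                  + f n (A - + 1) (B - A + + 1) + + f n A (B - A)
                  + A * + f n A (B - A + + 1)
                  + (A + + 1) * + f n (A + + 1) (B - A))
             × (f 0 (+ 0) (+ 0) ≡ 1)
             × ((A B : ℤ) → (A , B) ≢ (+ 0 , + 0) → f 0 A B ≡ 0)
theorem4p1 = recurrence , refl , f-empty-vanishes
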